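{- Every sequence $\sigma:\mathbb{Z}_{>0}\to\Sigma$ that is both completely additive and ultimately periodic is the constant zero sequence.
   Context: $\Sigma$ is a finite cyclic (additive) group. Completely additive: $\sigma(1)=0$ and $\sigma(nm)=\sigma(n)+\sigma(m)$ for all $n,m\ge1$. Ultimately periodic: there are $n_0$ and $t\ge1$ with $\sigma(n+t)=\sigma(n)$ for all $n\ge n_0$. -}

module Defs where

open import Level using (Level)
open import Data.Nat using (ℕ; suc; _+_; _*_; _≤_)
open import Data.Fin using (Fin)
open import Data.Product using (Σ; ∃; _×_; _,_)
open import Algebra.Bundles using (AbelianGroup)
import Algebra.Definitions.RawMonoid as RM

module _ {c ℓ : Level} (G : AbelianGroup c ℓ) where
  open AbelianGroup G

  infixr 8 _·_
  _·_ : ℕ → Carrier → Carrier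
  _·_ = RM._×_ rawMonoid

  IsFinite : Set _
  IsFinite = Σ ℕ λ n → Σ (Fin n → Carrier) λ f → ∀ (x : Carrier) → ∃ λ i → f i ≈ x

  IsCyclic : Set _
  IsCyclic = Σ Carrier λ g → ∀ (x : Carrier) → ∃ λ (k : ℕ) → x ≈ k · g

  -- σ : ℤ_{>0} → Σ, represented as a function on ℕ of which only the
  -- values at n ≥ 1 are used.
  CompletelyAdditive : (ℕ → Carrier) → Set _
  CompletelyAdditive σ =
    (σ 1 ≈ ε) × (∀ n m → 1 ≤ n → 1 ≤ m → σ (n * m) ≈ σ n ∙ σ m)

  UltimatelyPeriodic : (ℕ → Carrier) → Set _
  UltimatelyPeriodic σ =
    Σ ℕ λ n₀ → Σ ℕ λ t → (1 ≤ t) × (∀ n → 1 ≤ n → n₀ ≤ n → σ (n + t) ≈ σ n)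

module Submission where

-- Let n₀ be the threshold and t ≥ 1 the period, and put x = (n₀ + 1)·t, a
-- multiple of the period lying past the threshold.  For every n ≥ 1 the
-- number n·x lies on the progression x, x + t, x + 2t, …, on which σ is
-- constant, so σ(n·x) = σ(x).  Complete additivity gives
-- σ(n·x) = σ(n) + σ(x), and cancelling σ(x) yields σ(n) = 0.

open import Defs
open import Level using (Level)
open import Data.Nat using (ℕ; zero; suc; _+_; _*_; _≤_; s≤s; z≤n)
open import Data.Nat.Properties
  using (≤-trans; m≤m+n; m≤m*n; n≤1+n; +-identityʳ; +-assoc; +-comm; *-assoc)
open import Data.Product using (_,_)
open import Algebra.Bundles using (AbelianGroup)
import Algebra.Properties.Group as GroupProperties
import Relation.Binary.Reasoning.Setoid as SetoidReasoning
open import Relation.Binary.PropositionalEquality as ≡ using (_≡_)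

module _ {c ℓ : Level} (G : AbelianGroup c ℓ) where
  open AbelianGroup G
  open GroupProperties group using (∙-cancelʳ)
  open SetoidReasoning setoid

  constant-on-progression : (σ : ℕ → Carrier) (n₀ t : ℕ) →
    (∀ n → 1 ≤ n → n₀ ≤ n → σ (n + t) ≈ σ n) →
    ∀ x → 1 ≤ x → n₀ ≤ x → ∀ k → σ (x + k * t) ≈ σ x
  constant-on-progression σ n₀ t periodic x 1≤x n₀≤x zero =
    reflexive (≡.cong σ (+-identityʳ x))
  constant-on-progression σ n₀ t periodic x 1≤x n₀≤x (suc k) = begin
    σ (x + (t + k * t))  ≡⟨ ≡.cong σ regroup ⟩
    σ (x + k * t + t)    ≈⟨ periodic (x + k * t) (≤-trans 1≤x x≤x+kt) (≤-trans n₀≤x x≤x+kt) ⟩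
    σ (x + k * t)        ≈⟨ constant-on-progression σ n₀ t periodic x 1≤x n₀≤x k ⟩
    σ x                  ∎
    where
    x≤x+kt : x ≤ x + k * t
    x≤x+kt = m≤m+n x (k * t)

    regroup : x + (t + k * t) ≡ x + k * t + t
    regroup = ≡.trans (≡.cong (x +_) (+-comm t (k * t))) (≡.sym (+-assoc x (k * t) t))

  additive-fixed-multiple : (σ : ℕ → Carrier) → CompletelyAdditive G σ →
    ∀ a x → 1 ≤ a → 1 ≤ x → σ (a * x) ≈ σ x → σ a ≈ ε
  additive-fixed-multiple σ (_ , additive) a x 1≤a 1≤x fixed =
    ∙-cancelʳ (σ x) (σ a) ε (begin
      σ a ∙ σ x  ≈⟨ additive a x 1≤a 1≤x ⟨
      σ (a * x)  ≈⟨ fixed ⟩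
      σ x        ≈⟨ identityˡ (σ x) ⟨
      ε ∙ σ x    ∎)

mainTheorem10 : ∀ {c ℓ : Level} (G : AbelianGroup c ℓ) → IsFinite G → IsCyclic G →
    (σ : ℕ → AbelianGroup.Carrier G) → CompletelyAdditive G σ → UltimatelyPeriodic G σ →
    ∀ n → 1 ≤ n → AbelianGroup._≈_ G (σ n) (AbelianGroup.ε G)
mainTheorem10 G _ _ σ additive (n₀ , suc t′ , _ , periodic) (suc m) 1≤n =
  additive-fixed-multiple G σ additive (suc m) x 1≤n 1≤x multiple-fixed
  where
  open AbelianGroup G using (_≈_; trans; reflexive)

  t : ℕ
  t = suc t′

  x : ℕ
  x = suc n₀ * t

  n₀<x : suc n₀ ≤ x
  n₀<x = m≤m*n (suc n₀) t

  1≤x : 1 ≤ x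
  1≤x = ≤-trans (s≤s z≤n) n₀<x

  n₀≤x : n₀ ≤ x
  n₀≤x = ≤-trans (n≤1+n n₀) n₀<x

  -- (m + 1)·x = x + m·((n₀ + 1)·t) = x + (m·(n₀ + 1))·t
  multiple-fixed : σ (suc m * x) ≈ σ x
  multiple-fixed = trans
    (reflexive (≡.cong (λ k → σ (x + k)) (≡.sym (*-assoc m (suc n₀) t))))
    (constant-on-progression G σ n₀ t periodic x 1≤x n₀≤x (m * suc n₀))
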